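{- Let $I=(U,V,E,\Sigma_U,\Sigma_V,\{P_u\},\{f_e\})$ be a left-predicate label cover instance, let $(B,\{C_1,\dots,C_m\})$ be an $(m,l)$-set system with $m=|\Sigma_V|$ (identifying $\Sigma_V$ with $[m]$), let $I'=\mathcal T_{\mathrm{SC}}(I)$, and let $\mathcal S\subseteq\Lambda_I$ be a cover of $I'$. Fix an edge $e=(u,v)\in E$ and let $t_e:=|L_u|+|L_v|$. If $t_e\le l$, then for $\boldsymbol\pi\sim\mathcal R_{\mathrm{SC},I}(\mathcal S)$, $\Pr[\boldsymbol\pi\text{ satisfies }e]\ge 4/l^2$.
   Context: An assignment $\pi$ satisfies edge $(u,v)$ iff $P_u(\pi(u))=1$ and $f_{(u,v)}(\pi(u))=\pi(v)$. An $(m,l)$-set system is a universe $B$ with subsets $C_1,\dots,C_m$ such that whenever a collection of at most $l$ sets from $\{C_1,\dots,C_m,\overline{C_1},\dots,\overline{C_m}\}$ ($\overline{C}=B\setminus C$) covers $B$, it contains both $C_i$ and $\overline{C_i}$ for some $i$. $\mathcal T_{\mathrm{SC}}(I)$ is the set cover instance with ground set $E\times B$ and indexed family $(S_\lambda)_{\lambda\in\Lambda_I}$, $\Lambda_I=(V\times\Sigma_V)\sqcup(U\times\Sigma_U)$, where $S_{v,x}=\bigcup_{e\ni v}\{e\}\times C_x$, and $S_{u,y}=\bigcup_{e\ni u}\{e\}\times\overline{C_{f_e(y)}}$ if $P_u(y)=1$ and $S_{u,y}=\emptyset$ otherwise. A cover is $\mathcal S\subseteq\Lambda_I$ with $\bigcup_{\lambda\in\mathcal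 S}S_\lambda=E\times B$. Recovery $\mathcal R_{\mathrm{SC},I}(\mathcal S)$: let $L_u=\{y\in\Sigma_U:(u,y)\in\mathcal S,P_u(y)=1\}$ and $L_v=\{x:(v,x)\in\mathcal S\}$; independently choose $\boldsymbol\pi(u)$ uniformly from $L_u$ and $\boldsymbol\pi(v)$ uniformly from $L_v$ (a fixed label if the set is empty). -}

module Defs where

open import Data.Nat using (ℕ; zero; suc; _≤_; _+_; _*_)
open import Data.Fin using (Fin; _≟_)
open import Data.Bool using (Bool; true; false; _∧_)
open import Data.List using (List; []; _∷_; length; filterᵇ; allFin; cartesianProduct)
open import Data.List.Membership.Propositional using (_∈_)
open import Data.List.Relation.Unary.Unique.Propositional using (Unique)
open import Data.Product using (_×_; _,_; Σ; ∃; proj₁; proj₂)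
open import Data.Sum using (_⊎_; inj₁; inj₂)
open import Data.Integer using (+_)
open import Data.Rational using (ℚ; 0ℚ; _/_)
open import Relation.Binary.PropositionalEquality using (_≡_)
open import Relation.Nullary.Decidable using (⌊_⌋)

-- Left-predicate label cover instance.
-- U = Fin nU, V = Fin nV, E = Fin nE (edge e goes from src e ∈ U to dst e ∈ V),
-- Σ_U = Fin k, Σ_V = Fin m.
record LabelCover : Set where
  field
    nU nV nE k m : ℕ
    src : Fin nE → Fin nU
    dst : Fin nE → Fin nV
    P   : Fin nU → Fin k → Bool
    f   : Fin nE → Fin k → Fin m

-- A set system on universe B = Fin nB with sets C_1..C_m (C i b ≡ true iff b ∈ C_i).
-- Literals (i , true) stands for C_i, (i , false) for its complement.
Literal : ℕ → Set
Literal m = Fin m × Bool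

litMem : {m nB : ℕ} → (Fin m → Fin nB → Bool) → Literal m → Fin nB → Set
litMem C (i , true)  b = C i b ≡ true
litMem C (i , false) b = C i b ≡ false

IsSetSystem : (m l nB : ℕ) → (Fin m → Fin nB → Bool) → Set
IsSetSystem m l nB C =
  (cs : List (Literal m)) → Unique cs → length cs ≤ l →
  (∀ (b : Fin nB) → Σ (Literal m) λ c → c ∈ cs × litMem C c b) →
  ∃ λ (i : Fin m) → (i , true) ∈ cs × (i , false) ∈ cs

module _ (I : LabelCover) where
  open LabelCover I

  Λ : Set
  Λ = (Fin nV × Fin m) ⊎ (Fin nU × Fin k)

  -- (e , b) ∈ S_λ for the instance T_SC(I) with set system C on Fin nB
  InS : {nB : ℕ} → (Fin m → Fin nB → Bool) → Λ → Fin nE → Fin nB → Set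
  InS C (inj₁ (v , x)) e b = dst e ≡ v × C x b ≡ true
  InS C (inj₂ (u , y)) e b = src e ≡ u × P u y ≡ true × C (f e y) b ≡ false

  IsCover : {nB : ℕ} → (Fin m → Fin nB → Bool) → (Λ → Bool) → Set
  IsCover {nB} C S = ∀ (e : Fin nE) (b : Fin nB) →
    Σ Λ λ lam → S lam ≡ true × InS C lam e b

  Lu : (Λ → Bool) → Fin nU → List (Fin k)
  Lu S u = filterᵇ (λ y → S (inj₂ (u , y)) ∧ P u y) (allFin k)

  Lv : (Λ → Bool) → Fin nV → List (Fin m)
  Lv S v = filterᵇ (λ x → S (inj₁ (v , x))) (allFin m)

  -- support of the uniform choice: the list, or the fixed label if empty
  support : {A : Set} → A → List A → List A
  support d [] = d ∷ []
  support d (x ∷ xs) = x ∷ xs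

  satCount : (Λ → Bool) → Fin k → Fin m → Fin nE → ℕ
  satCount S du dv e =
    length (filterᵇ (λ p → P (src e) (proj₁ p) ∧ ⌊ f e (proj₁ p) ≟ proj₂ p ⌋)
      (cartesianProduct (support du (Lu S (src e))) (support dv (Lv S (dst e)))))

  sampleSize : (Λ → Bool) → Fin k → Fin m → Fin nE → ℕ
  sampleSize S du dv e =
    length (support du (Lu S (src e))) * length (support dv (Lv S (dst e)))

-- a / b as a rational (with the convention a / 0 = 0, never used for b = 0 below
-- except in the degenerate l = 0 case)
ratio : ℕ → ℕ → ℚ
ratio a zero = 0ℚ
ratio a (suc n) = (+ a) / suc n

-- Pr over π ~ R_SC,I(S) (du, dv are the fixed labels used when L_u / L_v is empty)
-- that π satisfies edge e
PrSat : (I : LabelCover) → (Λ I → Bool) → Fin (LabelCover.k I) → Fin (LabelCover.m I) →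
        Fin (LabelCover.nE I) → ℚ
PrSat I S du dv e = ratio (satCount I S du dv e) (sampleSize I S du dv e)

-- Restricted to edge e = (u, v), the cover S uses the sets C_x (x ∈ L_v) and the complements
-- of C_{f_e(y)} (y ∈ L_u), and these at most l sets cover B.  The set-system property then
-- forces f_e(y) = x for some y ∈ L_u, x ∈ L_v, so at least one of the |L_u|·|L_v| equally
-- likely label pairs satisfies e; by AM-GM, |L_u|·|L_v| ≤ (|L_u| + |L_v|)²/4 ≤ l²/4.
module Submission where

open import Defs
open import Data.Nat using (ℕ; _≤_; _+_; _*_)
open import Data.Fin using (Fin)
open import Data.Bool using (Bool)
open import Data.List using (length)
open import Data.Rational using (ℚ) renaming (_≤_ to _≤ℚ_)

open import Data.Nat using (suc; z≤n; s≤s)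
open import Data.Nat.Properties
  using (module ≤-Reasoning; ≤-total; ≤-trans; ≤-reflexive; m≤m+n; m≤n⇒∃[o]m+o≡n; *-comm; +-comm; *-mono-≤; *-monoˡ-≤; *-identityˡ)
open import Data.Nat.Solver using (module +-*-Solver)
open import Data.Bool using (true; false; _∧_; T?)
open import Data.Bool.Properties using (T-≡; ∧-conicalʳ)
import Data.Bool.Properties as Bool
import Data.Fin.Properties as Fin
open import Data.List using (List; _∷_; map; _++_; filterᵇ; allFin; deduplicate)
open import Data.List.Properties using (length-deduplicate; length-++; length-map)
open import Data.List.Membership.Propositional using (_∈_)
open import Data.List.Membership.Propositional.Properties
  using (∈-map⁺; ∈-map⁻; ∈-++⁺ˡ; ∈-++⁺ʳ; ∈-++⁻; ∈-filter⁺; ∈-filter⁻; ∈-deduplicate⁺; ∈-deduplicate⁻; ∈-allFin; ∈-cartesianProduct⁺)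
open import Data.List.Relation.Unary.Unique.DecPropositional.Properties using (deduplicate-!)
open import Data.Product using (_×_; _,_; Σ; ∃; ∃₂; proj₂)
open import Data.Product.Properties using (≡-dec)
open import Data.Sum using (_⊎_; inj₁; inj₂)
open import Data.Integer as ℤ using (+_)
import Data.Integer.Properties as ℤ
import Data.Rational.Properties as ℚ
import Data.Rational.Unnormalised as ℚᵘ
import Data.Rational.Unnormalised.Properties as ℚᵘ
open import Function using (_∘_)
open import Function.Bundles using (Equivalence)
open import Relation.Binary.PropositionalEquality using (module ≡-Reasoning; _≡_; refl; sym; cong; cong₂; subst; subst₂)
open import Relation.Nullary.Decidable using (Dec; fromWitness)

-- ratio reduces by the gcd, so compare the unnormalised fractions a/(1+b) and c/(1+d) instead.
ratio-mono : ∀ a b c d → a * suc d ≤ c * suc b → ratio a (suc b) ≤ℚ ratio c (suc d)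
ratio-mono a b c d ad≤cb = ℚ.toℚᵘ-cancel-≤
  (ℚᵘ.≤-respˡ-≃ (ℚᵘ.≃-sym (ℚ.toℚᵘ-fromℚᵘ (ℚᵘ.mkℚᵘ (+ a) b)))
    (ℚᵘ.≤-respʳ-≃ (ℚᵘ.≃-sym (ℚ.toℚᵘ-fromℚᵘ (ℚᵘ.mkℚᵘ (+ c) d)))
      (ℚᵘ.*≤* (subst₂ ℤ._≤_ (ℤ.pos-* a (suc d)) (ℤ.pos-* c (suc b)) (ℤ.+≤+ ad≤cb)))))

[m+[m+d]]²≡4*[m*[m+d]]+d² : ∀ m d → (m + (m + d)) * (m + (m + d)) ≡ 4 * (m * (m + d)) + d * d
[m+[m+d]]²≡4*[m*[m+d]]+d² = solve 2 (λ m d → (m :+ (m :+ d)) :* (m :+ (m :+ d))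
                                           := con 4 :* (m :* (m :+ d)) :+ d :* d) refl
  where open +-*-Solver

m≤n⇒4*[m*n]≤[m+n]*[m+n] : ∀ {m n} → m ≤ n → 4 * (m * n) ≤ (m + n) * (m + n)
m≤n⇒4*[m*n]≤[m+n]*[m+n] {m} m≤n with m≤n⇒∃[o]m+o≡n m≤n
... | d , refl = subst (4 * (m * (m + d)) ≤_) (sym ([m+[m+d]]²≡4*[m*[m+d]]+d² m d)) (m≤m+n _ (d * d))

4*[m*n]≤[m+n]*[m+n] : ∀ m n → 4 * (m * n) ≤ (m + n) * (m + n)
4*[m*n]≤[m+n]*[m+n] m n with ≤-total m n
... | inj₁ m≤n = m≤n⇒4*[m*n]≤[m+n]*[m+n] m≤n
... | inj₂ n≤m = subst₂ _≤_ (cong (4 *_) (*-comm n m)) (cong₂ _*_ (+-comm n m) (+-comm n m))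
                   (m≤n⇒4*[m*n]≤[m+n]*[m+n] n≤m)

4/l²≤ratio : ∀ {a b c l} → 1 ≤ a → 1 ≤ b → 1 ≤ c → a + b ≤ l → ratio 4 (l * l) ≤ℚ ratio c (a * b)
4/l²≤ratio {a@(suc _)} {b@(suc _)} {c} {l@(suc _)} _ _ 1≤c a+b≤l = ratio-mono 4 _ c _ (begin
  4 * (a * b)        ≤⟨ 4*[m*n]≤[m+n]*[m+n] a b ⟩
  (a + b) * (a + b)  ≤⟨ *-mono-≤ a+b≤l a+b≤l ⟩
  l * l              ≡⟨ *-identityˡ (l * l) ⟨
  1 * (l * l)        ≤⟨ *-monoˡ-≤ (l * l) 1≤c ⟩
  c * (l * l)        ∎)
  where open ≤-Reasoning

module _ {m l nB : ℕ} {C : Fin m → Fin nB → Bool} (system : IsSetSystem m l nB C) {A : Set} (g : A → Fin m) where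

  private
    _≟-lit_ : (c d : Literal m) → Dec (c ≡ d)
    _≟-lit_ = ≡-dec Fin._≟_ Bool._≟_

    complemented : List A → List (Literal m)
    complemented ys = map (λ y → g y , false) ys

    plain : List (Fin m) → List (Literal m)
    plain xs = map (_, true) xs

    -- Deduplicated because IsSetSystem only constrains duplicate-free collections.
    literals : List A → List (Fin m) → List (Literal m)
    literals ys xs = deduplicate _≟-lit_ (complemented ys ++ plain xs)

    length-literals : ∀ ys xs → length (literals ys xs) ≤ length ys + length xs
    length-literals ys xs =
      ≤-trans (length-deduplicate _≟-lit_ (complemented ys ++ plain xs)) (≤-reflexive (begin
      length (complemented ys ++ plain xs)           ≡⟨ length-++ (complemented ys) ⟩
      length (complemented ys) + length (plain xs)   ≡⟨ cong₂ _+_ (length-map _ ys) (length-map _ xs) ⟩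
      length ys + length xs                          ∎))
      where open ≡-Reasoning

    ∈-literals-false : ∀ {ys xs i} → (i , false) ∈ literals ys xs → ∃ λ y → y ∈ ys × i ≡ g y
    ∈-literals-false {ys} i∈ with ∈-++⁻ (complemented ys) (∈-deduplicate⁻ _≟-lit_ _ i∈)
    ... | inj₁ i∈ys with ∈-map⁻ _ i∈ys
    ...   | y , y∈ys , refl = y , y∈ys , refl
    ∈-literals-false {ys} i∈ | inj₂ i∈xs with ∈-map⁻ _ i∈xs
    ...   | _ , _ , ()

    ∈-literals-true : ∀ {ys xs i} → (i , true) ∈ literals ys xs → i ∈ xs
    ∈-literals-true {ys} i∈ with ∈-++⁻ (complemented ys) (∈-deduplicate⁻ _≟-lit_ _ i∈)
    ... | inj₁ i∈ys with ∈-map⁻ _ i∈ys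
    ...   | _ , _ , ()
    ∈-literals-true {ys} i∈ | inj₂ i∈xs with ∈-map⁻ _ i∈xs
    ...   | x , x∈xs , refl = x∈xs

  set-system-clash : (ys : List A) (xs : List (Fin m)) → length ys + length xs ≤ l →
    (∀ b → (∃ λ y → y ∈ ys × C (g y) b ≡ false) ⊎ (∃ λ x → x ∈ xs × C x b ≡ true)) →
    ∃₂ λ y x → y ∈ ys × x ∈ xs × g y ≡ x
  set-system-clash ys xs size≤l covers
    with system (literals ys xs) (deduplicate-! _≟-lit_ _) (≤-trans (length-literals ys xs) size≤l) covering
    where
    covering : ∀ b → Σ (Literal m) λ c → c ∈ literals ys xs × litMem C c b
    covering b with covers b
    ... | inj₁ (y , y∈ys , Cgy) = (g y , false) , ∈-deduplicate⁺ _≟-lit_ (∈-++⁺ˡ (∈-map⁺ _ y∈ys)) , Cgy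
    ... | inj₂ (x , x∈xs , Cx)  = (x , true) , ∈-deduplicate⁺ _≟-lit_ (∈-++⁺ʳ _ (∈-map⁺ _ x∈xs)) , Cx
  ... | i , i∈ , ī∈ with ∈-literals-false ī∈
  ...   | y , y∈ys , refl = y , g y , y∈ys , ∈-literals-true i∈ , refl

∈-filterᵇ⁺ : ∀ {A : Set} (p : A → Bool) {x xs} → x ∈ xs → p x ≡ true → x ∈ filterᵇ p xs
∈-filterᵇ⁺ p x∈xs px = ∈-filter⁺ (T? ∘ p) x∈xs (Equivalence.from T-≡ px)

∈-filterᵇ⁻ : ∀ {A : Set} (p : A → Bool) {x xs} → x ∈ filterᵇ p xs → p x ≡ true
∈-filterᵇ⁻ p {xs = xs} x∈ = Equivalence.to T-≡ (proj₂ (∈-filter⁻ (T? ∘ p) {xs = xs} x∈))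

support-∈ : ∀ (I : LabelCover) {A : Set} (d : A) {x xs} → x ∈ xs → support I d xs ≡ xs
support-∈ I d {xs = _ ∷ _} _ = refl

length-∈ : ∀ {A : Set} {x : A} {xs} → x ∈ xs → 1 ≤ length xs
length-∈ {xs = _ ∷ _} _ = s≤s z≤n

module _ (I : LabelCover) (S : Λ I → Bool) (e : Fin (LabelCover.nE I)) where
  open LabelCover I

  private
    u = src e
    v = dst e

  P-of-Lu : ∀ {y} → y ∈ Lu I S u → P u y ≡ true
  P-of-Lu y∈ = ∧-conicalʳ _ _ (∈-filterᵇ⁻ (λ y → S (inj₂ (u , y)) ∧ P u y) {xs = allFin k} y∈)

  cover-at-edge : ∀ {nB} {C : Fin m → Fin nB → Bool} → IsCover I C S → ∀ b →
    (∃ λ y → y ∈ Lu I S u × C (f e y) b ≡ false) ⊎ (∃ λ x → x ∈ Lv I S v × C x b ≡ true)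
  cover-at-edge cover b with cover e b
  ... | inj₁ (_ , x) , Sλ , refl , Cx     = inj₂ (x , ∈-filterᵇ⁺ _ (∈-allFin x) Sλ , Cx)
  ... | inj₂ (_ , y) , Sλ , refl , Py , Cy = inj₁ (y , ∈-filterᵇ⁺ _ (∈-allFin y) (cong₂ _∧_ Sλ Py) , Cy)

  module _ (du : Fin k) (dv : Fin m) {y x} (y∈Lu : y ∈ Lu I S u) (x∈Lv : x ∈ Lv I S v) where

    sampleSize-nonempty : sampleSize I S du dv e ≡ length (Lu I S u) * length (Lv I S v)
    sampleSize-nonempty rewrite support-∈ I du y∈Lu | support-∈ I dv x∈Lv = refl

    satCount-positive : f e y ≡ x → 1 ≤ satCount I S du dv e
    satCount-positive fy≡x rewrite support-∈ I du y∈Lu | support-∈ I dv x∈Lv =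
      length-∈ (∈-filterᵇ⁺ _ (∈-cartesianProduct⁺ y∈Lu x∈Lv)
        (cong₂ _∧_ (P-of-Lu y∈Lu) (Equivalence.to T-≡ (fromWitness fy≡x))))

lemma12p3 : (I : LabelCover) (l nB : ℕ) (C : Fin (LabelCover.m I) → Fin nB → Bool) →
    IsSetSystem (LabelCover.m I) l nB C →
    (S : Λ I → Bool) → IsCover I C S →
    (du : Fin (LabelCover.k I)) (dv : Fin (LabelCover.m I)) →
    (e : Fin (LabelCover.nE I)) →
    length (Lu I S (LabelCover.src I e)) + length (Lv I S (LabelCover.dst I e)) ≤ l →
    ratio 4 (l * l) ≤ℚ PrSat I S du dv e
lemma12p3 I l nB C system S cover du dv e t≤l
  with set-system-clash system (LabelCover.f I e) (Lu I S _) (Lv I S _) t≤l (cover-at-edge I S e cover)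
... | y , x , y∈Lu , x∈Lv , fy≡x
  rewrite sampleSize-nonempty I S e du dv y∈Lu x∈Lv =
  4/l²≤ratio (length-∈ y∈Lu) (length-∈ x∈Lv) (satCount-positive I S e du dv y∈Lu x∈Lv fy≡x) t≤l
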